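{- Let $G=(V,E)$ be a simple undirected graph with no isolated vertices, with a split partition $(K,I)$ (i.e. $V=K\cup I$ disjointly, $K$ a clique, $I$ an independent set) such that every vertex of $K$ has at least one neighbor in $I$. If $|I|=2$ and $|K|$ is odd, then $G$ is equimatchable.
   Context: A matching is a set of pairwise vertex-disjoint edges; it is maximal if it is not properly contained in another matching. A graph is equimatchable if all its maximal matchings have the same number of edges. A vertex is isolated if it has no neighbors. -}

module Defs where

open import Data.Nat using (ℕ; suc; _*_)
open import Data.Fin using (Fin)
open import Data.Fin.Subset using (Subset; _∈_; _∉_; ∣_∣; ∁)
open import Data.Product using (_×_; _,_; Σ; ∃; ∃-syntax)
open import Data.List using (List; []; _∷_; length; _++_)
open import Data.List.Relation.Unary.All using (All)
open import Data.List.Relation.Unary.Unique.Propositional using (Unique)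
import Data.List.Membership.Propositional as LM
open import Relation.Binary.PropositionalEquality using (_≡_)
open import Relation.Nullary using (¬_)
open import Data.Empty using (⊥)

record Graph (n : ℕ) : Set₁ where
  field
    Adj   : Fin n → Fin n → Set
    sym   : ∀ {u v} → Adj u v → Adj v u
    irrefl : ∀ {u} → ¬ Adj u u

module _ {n : ℕ} (G : Graph n) where
  open Graph G

  endpoints : List (Fin n × Fin n) → List (Fin n)
  endpoints [] = []
  endpoints ((u , v) ∷ es) = u ∷ v ∷ endpoints es

  -- a matching: a list of edges of G which are pairwise vertex-disjoint
  -- (all 2·|M| endpoints are distinct)
  IsMatching : List (Fin n × Fin n) → Set
  IsMatching M = All (λ e → Adj (Data.Product.proj₁ e) (Data.Product.proj₂ e)) M
               × Unique (endpoints M)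

  IsMaximalMatching : List (Fin n × Fin n) → Set
  IsMaximalMatching M = IsMatching M
    × (∀ u v → Adj u v → ¬ (LM._∉_ u (endpoints M) × LM._∉_ v (endpoints M)))

  Equimatchable : Set
  Equimatchable = ∀ M M′ → IsMaximalMatching M → IsMaximalMatching M′
                  → length M ≡ length M′

  NoIsolated : Set
  NoIsolated = ∀ u → ∃[ v ] Adj u v

  -- (K , complement of K) is a split partition: K clique, V ∖ K independent
  IsSplitPartition : Subset n → Set
  IsSplitPartition K =
      (∀ u v → u ∈ K → v ∈ K → ¬ u ≡ v → Adj u v)
    × (∀ u v → u ∉ K → v ∉ K → ¬ Adj u v)

  KDominatedByI : Subset n → Set
  KDominatedByI K = ∀ u → u ∈ K → ∃[ v ] (v ∉ K × Adj u v)

Odd : ℕ → Set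
Odd m = ∃[ k ] m ≡ suc (2 * k)

module Submission where

-- Two vertices left uncovered by M are never adjacent, so
-- at most one vertex x of the clique K is uncovered; if there is one, its
-- I-neighbour v must be covered.  Hence the uncovered vertices fit into a
-- list of length |I| (namely I, or x together with I without v).  Since the
-- 2|M| endpoints of M are distinct, counting vertices gives
--     n - |I|  ≤  2|M|  ≤  n .
-- For |I| = 2 and |K| = 2t+1 we have n = 2t+3, so 2t+1 ≤ 2|M| ≤ 2t+3, which
-- forces |M| = t+1 for every maximal matching: G is equimatchable.

open import Defs
open import Data.Nat using (ℕ; suc; _+_; _∸_; _≤_; s≤s; z≤n)
open import Data.Nat.Properties
  using (≤-antisym; ≤-trans; ≤-reflexive; ≤-pred; ≮⇒≥; <-irrefl; +-mono-≤; +-suc;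
         +-identityʳ; m∸n+n≡m; module ≤-Reasoning)
open import Data.Fin using (Fin) renaming (zero to fzero; suc to fsuc)
open import Data.Fin.Properties using (any?; _≟_)
open import Data.Fin.Subset using (Subset; inside; outside; _∈_; _∉_; ∣_∣; ∁)
open import Data.Fin.Subset.Properties using (_∈?_; x∉p⇒x∈∁p; ∣∁p∣≡n∸∣p∣; ∣p∣≤n)
open import Data.List using (List; []; _∷_; length; _++_; map)
open import Data.Vec using () renaming ([] to []ᵥ; _∷_ to _∷ᵥ_)
open import Data.Vec.Base using () renaming (there to thereᵥ)
open import Data.List.Properties using (length-map; length-++; length-tabulate; length-removeAt′)
open import Data.List.Relation.Unary.All as All using ()
open import Data.List.Relation.Unary.Any using (here; there; index)
open import Data.List.Relation.Unary.AllPairs using (_∷_)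
open import Data.List.Relation.Unary.Unique.Propositional using (Unique)
open import Data.List.Relation.Unary.Unique.Propositional.Properties using (allFin⁺)
open import Data.List.Relation.Binary.Subset.Propositional using (_⊆_)
open import Data.List.Membership.Propositional
  using (_─_) renaming (_∈_ to _∈ₗ_; _∉_ to _∉ₗ_)
open import Data.List.Membership.Propositional.Properties using (∈-++⁺ˡ; ∈-++⁺ʳ; ∈-allFin; ∈-map⁺)
import Data.List.Membership.DecPropositional as DecMembership
open import Data.Product using (_×_; _,_; ∃-syntax)
open import Data.Empty using (⊥-elim)
open import Relation.Nullary using (¬_; yes; no)
open import Relation.Nullary.Decidable using (_×-dec_; ¬?; decidable-stable)
open import Relation.Binary.PropositionalEquality
  using (_≡_; _≢_; refl; sym; trans; cong; cong₂; subst; subst₂; module ≡-Reasoning)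

module _ {A : Set} where

  ∈-─ : ∀ {x y} {xs : List A} (x∈xs : x ∈ₗ xs) → y ∈ₗ xs → y ≢ x → y ∈ₗ xs ─ x∈xs
  ∈-─ (here refl) (here refl) y≢x = ⊥-elim (y≢x refl)
  ∈-─ (here refl) (there y∈xs) _  = y∈xs
  ∈-─ (there _)   (here refl) _   = here refl
  ∈-─ (there x∈xs) (there y∈xs) y≢x = there (∈-─ x∈xs y∈xs y≢x)

  unique⇒length≤ : ∀ {xs ys : List A} → Unique xs → xs ⊆ ys → length xs ≤ length ys
  unique⇒length≤ {[]}     _                  _     = z≤n
  unique⇒length≤ {x ∷ xs} {ys} (x∉xs ∷ uniq) xs⊆ys = begin
      suc (length xs)          ≤⟨ s≤s (unique⇒length≤ uniq xs⊆ys─x) ⟩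
      suc (length (ys ─ x∈ys)) ≡⟨ sym (length-removeAt′ ys (index x∈ys)) ⟩
      length ys                ∎
    where
      open ≤-Reasoning
      x∈ys : x ∈ₗ ys
      x∈ys = xs⊆ys (here refl)
      xs⊆ys─x : xs ⊆ ys ─ x∈ys
      xs⊆ys─x y∈xs = ∈-─ x∈ys (xs⊆ys (there y∈xs)) (λ y≡x → All.lookup x∉xs y∈xs (sym y≡x))

unique⇒length≤n : ∀ {n} {xs : List (Fin n)} → Unique xs → length xs ≤ n
unique⇒length≤n {n} uniq =
  ≤-trans (unique⇒length≤ uniq (λ {u} _ → ∈-allFin u)) (≤-reflexive (length-tabulate (λ u → u)))

covering⇒n≤length : ∀ {n} {xs : List (Fin n)} → (∀ u → u ∈ₗ xs) → n ≤ length xs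
covering⇒n≤length {n} covers =
  ≤-trans (≤-reflexive (sym (length-tabulate (λ u → u)))) (unique⇒length≤ (allFin⁺ n) (λ {u} _ → covers u))

elements : ∀ {n} → Subset n → List (Fin n)
elements []ᵥ            = []
elements (inside ∷ᵥ S)  = fzero ∷ map fsuc (elements S)
elements (outside ∷ᵥ S) = map fsuc (elements S)

length-elements : ∀ {n} (S : Subset n) → length (elements S) ≡ ∣ S ∣
length-elements []ᵥ            = refl
length-elements (inside ∷ᵥ S)  = cong suc (trans (length-map fsuc (elements S)) (length-elements S))
length-elements (outside ∷ᵥ S) = trans (length-map fsuc (elements S)) (length-elements S)

∈-elements : ∀ {n} {S : Subset n} {u} → u ∈ S → u ∈ₗ elements S
∈-elements {S = inside ∷ᵥ _}  {fzero}  _            = here refl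
∈-elements {S = inside ∷ᵥ _}  {fsuc u} (thereᵥ u∈S) = there (∈-map⁺ fsuc (∈-elements u∈S))
∈-elements {S = outside ∷ᵥ _} {fsuc u} (thereᵥ u∈S) = ∈-map⁺ fsuc (∈-elements u∈S)

size-split : ∀ {n} (S : Subset n) → n ≡ ∣ ∁ S ∣ + ∣ S ∣
size-split {n} S = begin
    n                   ≡⟨ sym (m∸n+n≡m (∣p∣≤n S)) ⟩
    (n ∸ ∣ S ∣) + ∣ S ∣ ≡⟨ cong (_+ ∣ S ∣) (sym (∣∁p∣≡n∸∣p∣ S)) ⟩
    ∣ ∁ S ∣ + ∣ S ∣     ∎
  where open ≡-Reasoning

double-between : ∀ m t → suc (t + t) ≤ m + m → m + m ≤ suc (suc (suc (t + t))) → m ≡ suc t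
double-between m t lower upper = ≤-antisym m≤1+t 1+t≤m
  where
    1+t≤m : suc t ≤ m
    1+t≤m = ≮⇒≥ λ m<1+t →
      let m≤t = ≤-pred m<1+t in
      <-irrefl refl (≤-trans lower (+-mono-≤ m≤t m≤t))
    2+t+t≡t+2+t : suc (suc (t + t)) ≡ t + suc (suc t)
    2+t+t≡t+2+t = sym (trans (+-suc t (suc t)) (cong suc (+-suc t t)))
    m≤1+t : m ≤ suc t
    m≤1+t = ≮⇒≥ λ 1+t<m →
      <-irrefl refl (subst (λ k → suc (suc k) ≤ suc (suc (suc (t + t)))) (sym 2+t+t≡t+2+t)
        (≤-trans (+-mono-≤ 1+t<m 1+t<m) upper))

module _ {n : ℕ} (G : Graph n) where
  open Graph G using (Adj)
  open DecMembership (_≟_ {n}) using () renaming (_∈?_ to _∈ₗ?_)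

  IsClique : Subset n → Set
  IsClique K = ∀ u v → u ∈ K → v ∈ K → ¬ u ≡ v → Adj u v

  length-endpoints : ∀ M → length (endpoints G M) ≡ length M + length M
  length-endpoints []      = refl
  length-endpoints (_ ∷ M) =
    cong suc (trans (cong suc (length-endpoints M)) (sym (+-suc (length M) (length M))))

  Uncovered : List (Fin n × Fin n) → Fin n → Set
  Uncovered M u = u ∉ₗ endpoints G M

  -- Adjacent vertices cannot both be uncovered, so a maximal matching leaves
  -- at most one vertex of a clique uncovered.
  uncovered-in-clique : ∀ {K M u v} → IsClique K → IsMaximalMatching G M
    → u ∈ K → v ∈ K → Uncovered M u → Uncovered M v → u ≡ v
  uncovered-in-clique clique (_ , maximal) u∈K v∈K u-unc v-unc =
    decidable-stable (_ ≟ _) λ u≢v → maximal _ _ (clique _ _ u∈K v∈K u≢v) (u-unc , v-unc)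

  neighbour-covered : ∀ {M u v} → IsMaximalMatching G M → Uncovered M u → Adj u v
    → v ∈ₗ endpoints G M
  neighbour-covered (_ , maximal) u-unc uv =
    decidable-stable (_ ∈ₗ? _) λ v-unc → maximal _ _ uv (u-unc , v-unc)

  UncoveredFitIn : Subset n → List (Fin n × Fin n) → Set
  UncoveredFitIn K M = ∃[ R ] (length R ≡ ∣ ∁ K ∣ × (∀ u → Uncovered M u → u ∈ₗ R))

  -- If a clique vertex x is uncovered, its neighbour v outside K is covered,
  -- and every uncovered vertex is x or lies outside K and differs from v.
  uncovered-beside : ∀ {K M x v} → IsClique K → IsMaximalMatching G M
    → x ∈ K → Uncovered M x → v ∉ K → Adj x v → UncoveredFitIn K M
  uncovered-beside {K} {M} {x} {v} clique maxM x∈K x-unc v∉K xv =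
    x ∷ (elements (∁ K) ─ v∈I) , length-R , covers
    where
      v∈I : v ∈ₗ elements (∁ K)
      v∈I = ∈-elements (x∉p⇒x∈∁p v∉K)
      length-R : suc (length (elements (∁ K) ─ v∈I)) ≡ ∣ ∁ K ∣
      length-R = trans (sym (length-removeAt′ (elements (∁ K)) (index v∈I))) (length-elements (∁ K))
      covers : ∀ u → Uncovered M u → u ∈ₗ x ∷ (elements (∁ K) ─ v∈I)
      covers u u-unc with u ∈? K
      ... | yes u∈K = here (uncovered-in-clique clique maxM u∈K x∈K u-unc x-unc)
      ... | no u∉K  = there (∈-─ v∈I (∈-elements (x∉p⇒x∈∁p u∉K))
                        λ { refl → u-unc (neighbour-covered maxM x-unc xv) })

  uncovered-bound : ∀ {K M} → IsClique K → KDominatedByI G K → IsMaximalMatching G M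
    → UncoveredFitIn K M
  uncovered-bound {K} {M} clique dom maxM
    with any? (λ x → x ∈? K ×-dec ¬? (x ∈ₗ? endpoints G M))
  ... | yes (x , x∈K , x-unc) =
    let (v , v∉K , xv) = dom x x∈K in uncovered-beside clique maxM x∈K x-unc v∉K xv
  ... | no no-uncovered-in-K =
    elements (∁ K) , length-elements (∁ K) ,
    λ u u-unc → ∈-elements (x∉p⇒x∈∁p λ u∈K → no-uncovered-in-K (u , u∈K , u-unc))

  matching-bounds : ∀ {K M} → IsClique K → KDominatedByI G K → IsMaximalMatching G M
    → length M + length M ≤ n × n ≤ ∣ ∁ K ∣ + (length M + length M)
  matching-bounds {K} {M} clique dom maxM@((_ , distinct) , _)
    with uncovered-bound clique dom maxM
  ... | R , length-R , R-covers = upper , lower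
    where
      upper : length M + length M ≤ n
      upper = subst (_≤ n) (length-endpoints M) (unique⇒length≤n distinct)
      covers : ∀ u → u ∈ₗ R ++ endpoints G M
      covers u with u ∈ₗ? endpoints G M
      ... | yes covered = ∈-++⁺ʳ R covered
      ... | no  u-unc   = ∈-++⁺ˡ (R-covers u u-unc)
      lower : n ≤ ∣ ∁ K ∣ + (length M + length M)
      lower = subst (n ≤_) (trans (length-++ R) (cong₂ _+_ length-R (length-endpoints M)))
                (covering⇒n≤length covers)

lemma2p2 : (n : ℕ) (G : Graph n) (K : Subset n)
    → NoIsolated G
    → IsSplitPartition G K
    → KDominatedByI G K
    → ∣ ∁ K ∣ ≡ 2
    → Odd ∣ K ∣
    → Equimatchable G
lemma2p2 n G K _ (clique , _) dom |I|≡2 (t , |K|≡1+2t) M M′ maxM maxM′ =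
  trans (size maxM) (sym (size maxM′))
  where
    n≡3+2t : n ≡ 2 + suc (t + t)
    n≡3+2t = trans (size-split K)
      (cong₂ _+_ |I|≡2 (trans |K|≡1+2t (cong (λ s → suc (t + s)) (+-identityʳ t))))
    -- every maximal matching has t+1 edges, since 2t+1 ≤ 2|M| ≤ 2t+3
    size : ∀ {N} → IsMaximalMatching G N → length N ≡ suc t
    size {N} maxN with matching-bounds G clique dom maxN
    ... | upper , lower = double-between (length N) t
      (≤-pred (≤-pred (subst₂ _≤_ n≡3+2t (cong (_+ (length N + length N)) |I|≡2) lower)))
      (subst (length N + length N ≤_) n≡3+2t upper)
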